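{- Let $1\le r<n$ and let $\alpha\in\{0,1\}^n$ with $\alpha_{n-r+1}=0$. Let $A_0$ be the least element of $P(\alpha)$ (the diagonal matrix with diagonal $\alpha$) and let $S_0$ be the least element of $P(1,0^{r-1})$ (the $r\times r$ matrix with a $1$ in position $(1,1)$ and zeros elsewhere). Then for every non-minimal $A\in\mathcal{T}(\alpha)$ and every non-minimal $S\in\mathcal{T}(1,0^{r-1})$ we have $A_0+\widehat{S}\neq A+\widehat{S_0}$, i.e. the pairs $(A_0,S)$ and $(A,S_0)$ of $P(\alpha)\times P(1,0^{r-1})$ are not equivalent under the relation $(A_1,S_1)\sim(A_2,S_2)\iff A_1+\widehat{S_1}=A_2+\widehat{S_2}$.
   Context: Let $U_m$ be the set of $m\times m$ upper-triangular matrices with nonnegative integer entries. For $A=(a_{i,j})\in U_m$ and $1\le k\le m$, the $k$-th hook sum is $h_k=(a_{k,k}+\cdots+a_{k,m})-(a_{1,k}+\cdots+a_{k-1,k})$. For $\beta\in\mathbb{Z}_{\ge0}^m$, $\mathcal{T}(\beta)$ is the set of $A\in U_m$ with $(h_1,\ldots,h_m)=\beta$; $(1,0^{r-1})$ denotes $(1,0,\ldots,0)\in\mathbb{Z}^r$. The Tesler poset $P(\beta)$ is the partial order on $\mathcal{T}(\beta)$ that is the reflexive-transitive closure of the cover relation: $A=(a_{ij})$ covers $B=(b_{ij})$ if either there exist $i<j<k$ with $a_{ij}=b_{ij}+1$, $a_{jk}=b_{jk}+1$, $a_{ik}=b_{ik}-1$ and all other entries equal, or there exist $i<j$ with $a_{ij}=b_{ij}+1$,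 $a_{jj}=b_{jj}+1$, $a_{ii}=b_{ii}-1$ and all other entries equal; its least element is the diagonal matrix with diagonal $\beta$. For an $r\times r$ matrix $S=(s_{ij})$, $\widehat S$ is the $n\times n$ matrix with $\widehat S_{i+n-r,\,j+n-r}=s_{ij}$ and all other entries $0$ (i.e. $S$ placed in the lower right corner). -}

module Defs where

open import Data.Nat using (ℕ; zero; suc; _+_; _∸_; _≤_; _<?_; _≤?_)
open import Data.Fin using (Fin; zero; suc; toℕ; fromℕ<; _<_)
open import Data.Fin.Properties using (_≟_)
open import Data.Integer using (ℤ; +_; _-_)
open import Data.Maybe using (Maybe; just; nothing)
open import Data.Product using (_×_)
open import Relation.Nullary using (yes; no; ¬_)
open import Relation.Binary.PropositionalEquality using (_≡_)

-- m × m matrices with natural-number entries, 0-indexed: entry (i , j).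
Mat : ℕ → Set
Mat m = Fin m → Fin m → ℕ

sumFin : ∀ {m} → (Fin m → ℕ) → ℕ
sumFin {zero}  f = 0
sumFin {suc m} f = f zero + sumFin (λ i → f (suc i))

UpperTri : ∀ {m} → Mat m → Set
UpperTri {m} A = ∀ (i j : Fin m) → j < i → A i j ≡ 0

-- k-th hook sum  h_k = (a_{k,k}+...+a_{k,m}) - (a_{1,k}+...+a_{k-1,k})
hook : ∀ {m} → Mat m → Fin m → ℤ
hook A k =
  (+ sumFin (λ j → if≤ (toℕ k) (toℕ j) (A k j)))
  - (+ sumFin (λ i → ifLt (toℕ i) (toℕ k) (A i k)))
  where
  if≤ : ℕ → ℕ → ℕ → ℕ
  if≤ a b x with a ≤? b
  ... | yes _ = x
  ... | no  _ = 0
  ifLt : ℕ → ℕ → ℕ → ℕ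
  ifLt a b x with a <? b
  ... | yes _ = x
  ... | no  _ = 0

InTesler : ∀ {m} → (Fin m → ℕ) → Mat m → Set
InTesler {m} β A = UpperTri A × (∀ (k : Fin m) → hook A k ≡ + β k)

-- diagonal matrix with diagonal β (the least element of P(β))
diagM : ∀ {m} → (Fin m → ℕ) → Mat m
diagM β i j with i ≟ j
... | yes _ = β i
... | no  _ = 0

e₁ : ∀ {r} → Fin r → ℕ
e₁ zero    = 1
e₁ (suc _) = 0

_≐_ : ∀ {m} → Mat m → Mat m → Set
_≐_ {m} A B = ∀ (i j : Fin m) → A i j ≡ B i j

_⊕_ : ∀ {m} → Mat m → Mat m → Mat m
(A ⊕ B) i j = A i j + B i j

toFin? : ∀ r → ℕ → Maybe (Fin r)
toFin? r k with k <? r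
... | yes p = just (fromℕ< p)
... | no  _ = nothing

-- Ŝ : the r × r matrix S placed in the lower right corner of an n × n matrix
hat : ∀ {r} (n : ℕ) → Mat r → Mat n
hat {r} n S i j = go (shift (toℕ i)) (shift (toℕ j))
  where
  shift : ℕ → Maybe (Fin r)
  shift a with (n ∸ r) ≤? a
  ... | yes _ = toFin? r (a ∸ (n ∸ r))
  ... | no  _ = nothing
  go : Maybe (Fin r) → Maybe (Fin r) → ℕ
  go (just p) (just q) = S p q
  go _ _ = 0

-- Put p = n - r (0-indexed): the row and column where the corner block Ŝ
-- starts.  Comparing the (p,p) entries of  A₀ + Ŝ  and  A + Ŝ₀  gives
--   α_p + S₀₀ = A_pp + 1,  and  α_p = 0,  hence  S₀₀ ≥ 1.
-- On the other hand the least element of a Tesler poset is rigid: a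
-- matrix S ∈ 𝒯(β) whose diagonal dominates β (β_k ≤ S_kk for every k) is
-- the diagonal matrix diag(β).  For β = (1,0,…,0) domination just says
-- S₀₀ ≥ 1, so S would be minimal, contradicting the hypothesis.
module Submission where

open import Defs
open import Data.Nat using (ℕ; _≤_; _<_; _∸_)
open import Data.Fin using (Fin; toℕ)
open import Relation.Nullary using (¬_)
open import Relation.Binary.PropositionalEquality using (_≡_)

open import Data.Nat using (zero; suc; _+_; z≤n; s≤s; _≤?_; _<?_)
import Data.Nat.Properties as ℕ
open import Data.Fin using (fromℕ<)
import Data.Fin as Fin
open import Data.Fin.Properties using (_≟_; toℕ-fromℕ<)
open import Data.Fin.Induction using (<-wellFounded)
open import Data.Integer using (+_; _-_) renaming (_+_ to _+ℤ_; -_ to -ℤ_)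
import Data.Integer.Properties as ℤ
open import Data.Product using (Σ; _×_; _,_; proj₁; proj₂)
open import Induction.WellFounded using (module All)
open import Relation.Nullary using (yes; no; contradiction)
open import Relation.Binary.PropositionalEquality
  using (refl; sym; trans; cong; cong₂; subst; module ≡-Reasoning)

-- By definition  hook A k = + Σ_j rowTerm A k j - + Σ_i colTerm A k i
-- where the summands are the truncations local to  hook ; solving the two
-- summand functions by unification gives them names.
hookSplit : ∀ {m} (A : Mat m) (k : Fin m) →
  Σ (Fin m → ℕ) λ row → Σ (Fin m → ℕ) λ col →
    hook A k ≡ + sumFin row - + sumFin col
hookSplit A k = _ , _ , refl

-- rowTerm A k j = a_{kj} if k ≤ j, and 0 otherwise.
rowTerm : ∀ {m} → Mat m → Fin m → Fin m → ℕ
rowTerm A k = proj₁ (hookSplit A k)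

-- colTerm A k i = a_{ik} if i < k, and 0 otherwise.
colTerm : ∀ {m} → Mat m → Fin m → Fin m → ℕ
colTerm A k = proj₁ (proj₂ (hookSplit A k))

rowTerm-on : ∀ {m} (A : Mat m) k j → toℕ k ≤ toℕ j → rowTerm A k j ≡ A k j
rowTerm-on A k j k≤j with toℕ k ≤? toℕ j
... | yes _   = refl
... | no  k≰j = contradiction k≤j k≰j

colTerm-vanish : ∀ {m} (A : Mat m) k → (∀ i → toℕ i < toℕ k → A i k ≡ 0) →
  ∀ i → colTerm A k i ≡ 0
colTerm-vanish A k above≡0 i with toℕ i <? toℕ k
... | yes i<k = above≡0 i i<k
... | no  _   = refl

pos-minus-pos : ∀ R C b → + R - + C ≡ + b → R ≡ C + b
pos-minus-pos R C b eq = ℤ.+-injective (begin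
  + R                        ≡⟨ sym (ℤ.+-identityʳ (+ R)) ⟩
  + R +ℤ + 0                 ≡⟨ cong (+ R +ℤ_) (sym (ℤ.+-inverseˡ (+ C))) ⟩
  + R +ℤ (-ℤ (+ C) +ℤ + C)   ≡⟨ sym (ℤ.+-assoc (+ R) (-ℤ (+ C)) (+ C)) ⟩
  (+ R - + C) +ℤ + C         ≡⟨ cong (_+ℤ + C) eq ⟩
  + b +ℤ + C                 ≡⟨ sym (ℤ.pos-+ b C) ⟩
  + (b + C)                  ≡⟨ cong +_ (ℕ.+-comm b C) ⟩
  + (C + b)                  ∎)
  where open ≡-Reasoning

hook-balance : ∀ {m} (A : Mat m) k b → hook A k ≡ + b →
  sumFin (rowTerm A k) ≡ sumFin (colTerm A k) + b
hook-balance A k b = pos-minus-pos (sumFin (rowTerm A k)) (sumFin (colTerm A k)) b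

sumFin-zero : ∀ {m} (f : Fin m → ℕ) → (∀ i → f i ≡ 0) → sumFin f ≡ 0
sumFin-zero {zero}  f f≡0 = refl
sumFin-zero {suc m} f f≡0 =
  cong₂ _+_ (f≡0 Fin.zero) (sumFin-zero (λ i → f (Fin.suc i)) (λ i → f≡0 (Fin.suc i)))

term≤sum : ∀ {m} (f : Fin m → ℕ) i → f i ≤ sumFin f
term≤sum f Fin.zero    = ℕ.m≤m+n _ _
term≤sum f (Fin.suc i) = ℕ.≤-trans (term≤sum (λ i → f (Fin.suc i)) i) (ℕ.m≤n+m _ _)

pair≤sum : ∀ {m} (f : Fin m → ℕ) i j → ¬ i ≡ j → f i + f j ≤ sumFin f
pair≤sum f Fin.zero    Fin.zero    0≢0 = contradiction refl 0≢0
pair≤sum f Fin.zero    (Fin.suc j) _   = ℕ.+-monoʳ-≤ (f Fin.zero) (term≤sum (λ i → f (Fin.suc i)) j)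
pair≤sum f (Fin.suc i) Fin.zero    _   =
  subst (_≤ sumFin f) (ℕ.+-comm (f Fin.zero) (f (Fin.suc i)))
    (ℕ.+-monoʳ-≤ (f Fin.zero) (term≤sum (λ i → f (Fin.suc i)) i))
pair≤sum f (Fin.suc i) (Fin.suc j) i≢j =
  ℕ.≤-trans (pair≤sum (λ i → f (Fin.suc i)) i j (λ i≡j → i≢j (cong Fin.suc i≡j)))
            (ℕ.m≤n+m _ _)

concentrated : ∀ {m} (f : Fin m → ℕ) i {b} → sumFin f ≡ b → b ≤ f i →
  f i ≡ b × (∀ j → ¬ i ≡ j → f j ≡ 0)
concentrated f i {b} sum≡b b≤fi =
    ℕ.≤-antisym (subst (f i ≤_) sum≡b (term≤sum f i)) b≤fi
  , λ j i≢j → ℕ.n≤0⇒n≡0 (ℕ.+-cancelˡ-≤ b (f j) 0 (b+fj≤b+0 j i≢j))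
  where
  b+fj≤b+0 : ∀ j → ¬ i ≡ j → b + f j ≤ b + 0
  b+fj≤b+0 j i≢j = begin
    b + f j    ≤⟨ ℕ.+-monoˡ-≤ (f j) b≤fi ⟩
    f i + f j  ≤⟨ pair≤sum f i j i≢j ⟩
    sumFin f   ≡⟨ sum≡b ⟩
    b          ≡⟨ ℕ.+-identityʳ b ⟨
    b + 0      ∎
    where open ℕ.≤-Reasoning

diagM-diag : ∀ {m} (β : Fin m → ℕ) i → diagM β i i ≡ β i
diagM-diag β i with i ≟ i
... | yes _   = refl
... | no  i≢i = contradiction refl i≢i

diagM-off : ∀ {m} (β : Fin m → ℕ) i j → ¬ i ≡ j → diagM β i j ≡ 0
diagM-off β i j i≢j with i ≟ j
... | yes i≡j = contradiction i≡j i≢j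
... | no  _   = refl

RowDiagonal : ∀ {m} → (Fin m → ℕ) → Mat m → Fin m → Set
RowDiagonal β S k = ∀ j → S k j ≡ diagM β k j

-- Inductive step: if S ∈ 𝒯(β) dominates β on the diagonal and all rows
-- above k are diagonal, then column k vanishes above the diagonal, so the
-- k-th hook says that row k (from the diagonal on) sums to β_k; since
-- S_kk ≥ β_k the row is concentrated on S_kk = β_k.
row-diagonal-step : ∀ {m} (β : Fin m → ℕ) (S : Mat m) → InTesler β S →
  (∀ k → β k ≤ S k k) →
  ∀ k → (∀ {i} → toℕ i < toℕ k → RowDiagonal β S i) → RowDiagonal β S k
row-diagonal-step β S (upper , hooks) dominates k earlier = row-k
  where
  column-above≡0 : ∀ i → toℕ i < toℕ k → S i k ≡ 0
  column-above≡0 i i<k =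
    trans (earlier i<k k) (diagM-off β i k (λ i≡k → ℕ.<-irrefl (cong toℕ i≡k) i<k))

  row-sum : sumFin (rowTerm S k) ≡ β k
  row-sum = trans (hook-balance S k (β k) (hooks k))
                  (cong (_+ β k) (sumFin-zero (colTerm S k) (colTerm-vanish S k column-above≡0)))

  row-concentrated : rowTerm S k k ≡ β k × (∀ j → ¬ k ≡ j → rowTerm S k j ≡ 0)
  row-concentrated = concentrated (rowTerm S k) k row-sum
    (subst (β k ≤_) (sym (rowTerm-on S k k ℕ.≤-refl)) (dominates k))

  off-diagonal≡0 : ∀ j → ¬ k ≡ j → S k j ≡ 0
  off-diagonal≡0 j k≢j with toℕ k ≤? toℕ j
  ... | yes k≤j = trans (sym (rowTerm-on S k j k≤j)) (proj₂ row-concentrated j k≢j)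
  ... | no  k≰j = upper k j (ℕ.≰⇒> k≰j)

  row-k : RowDiagonal β S k
  row-k j with k ≟ j
  ... | yes refl = trans (sym (rowTerm-on S k k ℕ.≤-refl)) (proj₁ row-concentrated)
  ... | no  k≢j  = off-diagonal≡0 j k≢j

dominated⇒least : ∀ {m} (β : Fin m → ℕ) (S : Mat m) → InTesler β S →
  (∀ k → β k ≤ S k k) → S ≐ diagM β
dominated⇒least β S T dominates =
  All.wfRec <-wellFounded _ (RowDiagonal β S) (λ k → row-diagonal-step β S T dominates k)

hat-corner : ∀ {r} n (S : Mat (suc r)) (p : Fin n) → toℕ p ≡ n ∸ suc r →
  hat n S p p ≡ S Fin.zero Fin.zero
hat-corner {r} n S p p≡n-r with (n ∸ suc r) ≤? toℕ p
... | no  n-r≰p = contradiction (ℕ.≤-reflexive (sym p≡n-r)) n-r≰p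
... | yes _ rewrite ℕ.m≤n⇒m∸n≡0 (ℕ.≤-reflexive p≡n-r) = refl

mainTheorem7 : ∀ (n r : ℕ) → 1 ≤ r → r < n →
    ∀ (α : Fin n → ℕ) → (∀ i → α i ≤ 1) →
    (∀ (i : Fin n) → toℕ i ≡ n ∸ r → α i ≡ 0) →
    ∀ (A : Mat n) → InTesler α A → ¬ (A ≐ diagM α) →
    ∀ (S : Mat r) → InTesler e₁ S → ¬ (S ≐ diagM e₁) →
    ¬ ((diagM α ⊕ hat n S) ≐ (A ⊕ hat n (diagM {r} e₁)))
mainTheorem7 n (suc r) (s≤s z≤n) r<n α _ α-corner A _ _ S S∈𝒯 S≢least sums≐ =
  S≢least (dominated⇒least e₁ S S∈𝒯 dominates)
  where
  p<n : n ∸ suc r < n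
  p<n = ℕ.∸-monoʳ-< (s≤s z≤n) (ℕ.<⇒≤ r<n)

  p : Fin n
  p = fromℕ< p<n

  p-corner : toℕ p ≡ n ∸ suc r
  p-corner = toℕ-fromℕ< p<n

  corner-entry : S Fin.zero Fin.zero ≡ A p p + 1
  corner-entry = begin
    S Fin.zero Fin.zero            ≡⟨ hat-corner n S p p-corner ⟨
    hat n S p p                    ≡⟨ cong (_+ hat n S p p) (trans (diagM-diag α p) (α-corner p p-corner)) ⟨
    diagM α p p + hat n S p p      ≡⟨ sums≐ p p ⟩
    A p p + hat n (diagM {suc r} e₁) p p ≡⟨ cong (λ x → A p p + x) (trans (hat-corner n (diagM {suc r} e₁) p p-corner) (diagM-diag {suc r} e₁ Fin.zero)) ⟩
    A p p + 1                      ∎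
    where open ≡-Reasoning

  dominates : ∀ k → e₁ k ≤ S k k
  dominates Fin.zero    = subst (1 ≤_) (sym corner-entry) (ℕ.m≤n+m 1 (A p p))
  dominates (Fin.suc _) = z≤n
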